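{- Let $\mathcal{R}$ be a commutative ring with unity, $k\in\mathbb{N}\cup\{0\}$, and $(a_0,\ldots,a_k)\in\mathcal{R}^{k+1}$ with $\sum_{i=0}^k\langle a_i\rangle=\mathcal{R}$. Let $\mathcal{I}\subsetneq\mathcal{R}$ and $\mathcal{J}\subseteq\mathcal{R}$ be co-maximal ideals ($\mathcal{I}+\mathcal{J}=\mathcal{R}$), and suppose $\mathcal{I}$ satisfies the unital set condition (USC). Then for any index $0\le i\le k$ there exist $x_j\in\mathcal{J}$ for $j\in\{0,\ldots,k\}\setminus\{i\}$ such that $a_i+\sum_{j\neq i}x_ja_j$ is a unit modulo $\mathcal{I}$.
   Context: A finite subset of $\mathcal{R}$ is unital if it generates the unit ideal. An ideal $\mathcal{I}\subsetneq\mathcal{R}$ satisfies the USC if for every $n\ge2$ and every unital set $\{b_1,\ldots,b_n\}\subseteq\mathcal{R}$ there exists $b\in\langle b_2,\ldots,b_n\rangle$ such that $b_1+b$ is a unit modulo $\mathcal{I}$. -}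

module Defs where

open import Level using (Level; _⊔_)
open import Algebra.Bundles using (CommutativeRing)
open import Data.Nat using (ℕ; _≤_)
import Data.Nat as ℕ
open import Data.Fin using (Fin; zero; suc; punchIn)
open import Data.Product using (Σ; ∃; _×_; _,_)
open import Relation.Nullary using (¬_)

module CR {c ℓ : Level} (R : CommutativeRing c ℓ) where
  open CommutativeRing R hiding (zero)

  ∑ : ∀ {n} → (Fin n → Carrier) → Carrier
  ∑ {ℕ.zero}  f = 0#
  ∑ {ℕ.suc n} f = f zero + ∑ (λ i → f (suc i))

  record Ideal (p : Level) : Set (c ⊔ ℓ ⊔ Level.suc p) where
    field
      _∈I     : Carrier → Set p
      ∈-resp  : ∀ {x y} → x ≈ y → x ∈I → y ∈I
      0∈      : 0# ∈I
      +-closed : ∀ {x y} → x ∈I → y ∈I → (x + y) ∈I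
      *-closed : ∀ r {x} → x ∈I → (r * x) ∈I

  module _ {p : Level} where
    _∈_ : Carrier → Ideal p → Set p
    x ∈ I = Ideal._∈I I x

    Proper : Ideal p → Set (c ⊔ p)
    Proper I = ∃ λ x → ¬ (x ∈ I)

    CoMaximal : Ideal p → Ideal p → Set (c ⊔ ℓ ⊔ p)
    CoMaximal I J = Σ Carrier λ u → Σ Carrier λ v → u ∈ I × v ∈ J × (u + v ≈ 1#)

    UnitMod : Ideal p → Carrier → Set (c ⊔ p)
    UnitMod I x = ∃ λ y → (x * y - 1#) ∈ I

  InSpan : ∀ {n} → (Fin n → Carrier) → Carrier → Set (c ⊔ ℓ)
  InSpan {n} b x = Σ (Fin n → Carrier) λ r → x ≈ ∑ (λ i → r i * b i)

  Unital : ∀ {n} → (Fin n → Carrier) → Set (c ⊔ ℓ)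
  Unital b = InSpan b 1#

  -- the unital set condition: for every n ≥ 2 and every unital {b_1,…,b_n}
  -- (here b zero, b (suc 0), …, b (suc (m-1)) with n = m+1) there is
  -- b' ∈ ⟨b_2,…,b_n⟩ with b_1 + b' a unit modulo I
  USC : ∀ {p} → Ideal p → Set (c ⊔ ℓ ⊔ p)
  USC I = ∀ (m : ℕ) → 1 ≤ m → (b : Fin (ℕ.suc m) → Carrier) → Unital b →
          Σ Carrier λ b' → InSpan (λ i → b (suc i)) b' × UnitMod I (b zero + b')

{-# OPTIONS --safe #-}
-- Choose u ∈ I and v ∈ J with u + v = 1. Multiplying 1 = Σ r_j a_j by v shows that
-- a_i, u and the products v a_j (j ≠ i) generate the unit ideal, so the USC gives s with
-- a_i + s₀ u + Σ_{j≠i} s_j v a_j a unit modulo I. As s₀ u ∈ I it can be dropped,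
-- leaving the coefficients x_j = s_j v ∈ J.
module Submission where

open import Defs
open import Level using (Level)
open import Algebra.Bundles using (CommutativeRing)
open import Data.Nat using (ℕ; s≤s; z≤n)
open import Data.Fin using (Fin; punchIn; zero; suc)
open import Data.Vec.Functional using (Vector; _∷_; map; removeAt)
open import Data.Product using (Σ; _×_; _,_)
open import Function using (_∘_)
import Relation.Binary.PropositionalEquality as ≡

module Properties {c ℓ : Level} (R : CommutativeRing c ℓ) where
  open CommutativeRing R hiding (zero)
  open CR R
  open import Algebra.Properties.Semiring.Sum semiring
    using (sum; sum-cong-≋; sum-remove; *-distribˡ-sum)
  open import Algebra.Properties.Ring ring using (-1*x≈-x)
  open import Algebra.Properties.Group +-group using (//-rightDividesʳ)
  open import Algebra.Properties.CommutativeSemigroup +-commutativeSemigroup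
    using () renaming (x∙yz≈y∙xz to x+yz≈y+xz; x∙yz≈xz∙y to x+yz≈xz+y; xy∙z≈xz∙y to xy+z≈xz+y)
  open import Algebra.Properties.CommutativeSemigroup *-commutativeSemigroup
    using () renaming (x∙yz≈y∙xz to x*yz≈y*xz)
  open import Relation.Binary.Reasoning.Setoid setoid

  ∑≡sum : ∀ {n} (f : Vector Carrier n) → ∑ f ≡.≡ sum f
  ∑≡sum {ℕ.zero}  f = ≡.refl
  ∑≡sum {ℕ.suc n} f = ≡.cong (f zero +_) (∑≡sum (f ∘ suc))

  ∑-cong : ∀ {n} {f g : Vector Carrier n} → (∀ j → f j ≈ g j) → ∑ f ≈ ∑ g
  ∑-cong {f = f} {g} f≈g = begin
    ∑ f   ≡⟨ ∑≡sum f ⟩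
    sum f ≈⟨ sum-cong-≋ f≈g ⟩
    sum g ≡⟨ ∑≡sum g ⟨
    ∑ g   ∎

  ∑-remove : ∀ {n} (f : Vector Carrier (ℕ.suc n)) i → ∑ f ≈ f i + ∑ (removeAt f i)
  ∑-remove f i = begin
    ∑ f                      ≡⟨ ∑≡sum f ⟩
    sum f                    ≈⟨ sum-remove f ⟩
    f i + sum (removeAt f i) ≡⟨ ≡.cong (f i +_) (∑≡sum (removeAt f i)) ⟨
    f i + ∑ (removeAt f i)   ∎

  *-distribˡ-∑ : ∀ {n} x (f : Vector Carrier n) → x * ∑ f ≈ ∑ (map (x *_) f)
  *-distribˡ-∑ x f = begin
    x * ∑ f              ≡⟨ ≡.cong (x *_) (∑≡sum f) ⟩
    x * sum f            ≈⟨ *-distribˡ-sum x f ⟩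
    sum (map (x *_) f)   ≡⟨ ∑≡sum (map (x *_) f) ⟨
    ∑ (map (x *_) f)     ∎

  module _ {p : Level} (I : Ideal p) where

    ∈-cancelʳ : ∀ {x w} → (x + w) ∈ I → w ∈ I → x ∈ I
    ∈-cancelʳ {x} {w} x+w∈I w∈I =
      Ideal.∈-resp I (//-rightDividesʳ w x)
        (Ideal.+-closed I x+w∈I (Ideal.∈-resp I (-1*x≈-x w) (Ideal.*-closed I (- 1#) w∈I)))

    UnitMod-resp : ∀ {x x′} → x ≈ x′ → UnitMod I x → UnitMod I x′
    UnitMod-resp x≈x′ (y , xy-1∈I) = y , Ideal.∈-resp I (+-congʳ (*-congʳ x≈x′)) xy-1∈I

    UnitMod-cancelʳ : ∀ {x w} → w ∈ I → UnitMod I (x + w) → UnitMod I x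
    UnitMod-cancelʳ {x} {w} w∈I (y , e∈I) = y , ∈-cancelʳ (Ideal.∈-resp I expand e∈I) (Ideal.*-closed I y w∈I)
      where
        expand : (x + w) * y - 1# ≈ (x * y - 1#) + y * w
        expand = begin
          (x + w) * y - 1#        ≈⟨ +-congʳ (distribʳ y x w) ⟩
          (x * y + w * y) - 1#    ≈⟨ xy+z≈xz+y (x * y) (w * y) (- 1#) ⟩
          (x * y - 1#) + w * y    ≈⟨ +-congˡ (*-comm w y) ⟩
          (x * y - 1#) + y * w    ∎

  InSpan-removeAt : ∀ {n} (a : Vector Carrier (ℕ.suc n)) i {x} →
                    InSpan a x → InSpan (a i ∷ removeAt a i) x
  InSpan-removeAt a i (r , x≈) =
    (r i ∷ removeAt r i) , trans x≈ (∑-remove (λ j → r j * a j) i)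

  Unital-comaximal : ∀ {n} {c′ u v} {f : Vector Carrier n} → u + v ≈ 1# →
                     Unital (c′ ∷ f) → Unital (c′ ∷ u ∷ map (v *_) f)
  Unital-comaximal {c′ = c′} {u} {v} {f} u+v≈1 (r , 1≈) =
    (v * r zero ∷ 1# ∷ r ∘ suc) , (begin
      1#                                      ≈⟨ sym u+v≈1 ⟩
      u + v                                   ≈⟨ +-congˡ (sym (*-identityʳ v)) ⟩
      u + v * 1#                              ≈⟨ +-congˡ (*-congˡ 1≈) ⟩
      u + v * (r zero * c′ + ∑ rf)            ≈⟨ +-congˡ (distribˡ v (r zero * c′) (∑ rf)) ⟩
      u + (v * (r zero * c′) + v * ∑ rf)      ≈⟨ x+yz≈y+xz u _ _ ⟩
      v * (r zero * c′) + (u + v * ∑ rf)      ≈⟨ +-cong (sym (*-assoc v (r zero) c′))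
                                                         (+-cong (sym (*-identityˡ u)) vrf≈) ⟩
      (v * r zero) * c′ + (1# * u + ∑ (λ j → r (suc j) * (v * f j))) ∎)
    where
      rf : Vector Carrier _
      rf j = r (suc j) * f j
      vrf≈ : v * ∑ rf ≈ ∑ (λ j → r (suc j) * (v * f j))
      vrf≈ = trans (*-distribˡ-∑ v rf) (∑-cong (λ j → x*yz≈y*xz v (r (suc j)) (f j)))

  unitMod-comaximal-combination :
    ∀ {p k} (a : Vector Carrier (ℕ.suc k)) → Unital a →
    (I J : Ideal p) → CoMaximal I J → USC I → (i : Fin (ℕ.suc k)) →
    Σ (Vector Carrier k) λ x →
      (∀ j → x j ∈ J) × UnitMod I (a i + ∑ (λ j → x j * a (punchIn i j)))
  unitMod-comaximal-combination {k = k} a unital I J (u , v , u∈I , v∈J , u+v≈1) usc i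
    with usc (ℕ.suc k) (s≤s z≤n) (a i ∷ u ∷ map (v *_) (removeAt a i))
             (Unital-comaximal u+v≈1 (InSpan-removeAt a i unital))
  ... | b′ , (s , b′≈) , a+b′-unit =
    x , x∈J , UnitMod-cancelʳ I (Ideal.*-closed I (s zero) u∈I) (UnitMod-resp I regroup a+b′-unit)
    where
      x : Vector Carrier k
      x j = s (suc j) * v
      x∈J : ∀ j → x j ∈ J
      x∈J j = Ideal.*-closed J (s (suc j)) v∈J
      regroup : a i + b′ ≈ (a i + ∑ (λ j → x j * a (punchIn i j))) + s zero * u
      regroup = begin
        a i + b′                                                   ≈⟨ +-congˡ b′≈ ⟩
        a i + (s zero * u + ∑ (λ j → s (suc j) * (v * a (punchIn i j))))
          ≈⟨ +-congˡ (+-congˡ (∑-cong (λ j → sym (*-assoc (s (suc j)) v (a (punchIn i j)))))) ⟩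
        a i + (s zero * u + ∑ (λ j → x j * a (punchIn i j)))       ≈⟨ x+yz≈xz+y (a i) _ _ ⟩
        (a i + ∑ (λ j → x j * a (punchIn i j))) + s zero * u       ∎

mainTheorem14 : ∀ {c ℓ p : Level} (R : CommutativeRing c ℓ) →
    let open CommutativeRing R
        open CR R
    in (k : ℕ) (a : Fin (ℕ.suc k) → Carrier) → Unital a →
       (I J : Ideal p) → Proper I → CoMaximal I J → USC I →
       (i : Fin (ℕ.suc k)) →
       Σ (Fin k → Carrier) λ x →
         (∀ j → x j ∈ J) ×
         UnitMod I (a i + ∑ (λ j → x j * a (punchIn i j)))
mainTheorem14 R k a unital I J _ =
  Properties.unitMod-comaximal-combination R a unital I J
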